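{- Let $C$ be the poset with elements $0,1,2,3,4,5$ whose only strict order relations are $3<0$, $4<0$, $3<1$, $5<1$, $4<2$, $5<2$ (the 3-crown). Then $C$ admits no right-regular band operation $\cdot$ such that for all $x,y\in C$, $x\leq y\iff x\cdot y=x$; i.e., $C$ is not associative.
   Context: A right-regular band is a set with an associative binary operation satisfying $x\cdot x=x$ and $x\cdot y\cdot x=y\cdot x$. -}

module Defs where

open import Data.Fin using (Fin; zero; suc)
open import Relation.Binary.PropositionalEquality using (_≡_)
open import Relation.Nullary using (¬_)
open import Data.Product using (_×_)
open import Function.Bundles using (_⇔_)

C : Set
C = Fin 6

c0 c1 c2 c3 c4 c5 : C
c0 = zero
c1 = suc zero
c2 = suc (suc zero)
c3 = suc (suc (suc zero))
c4 = suc (suc (suc (suc zero)))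
c5 = suc (suc (suc (suc (suc zero))))

data _≤C_ : C → C → Set where
  refl≤ : ∀ {x} → x ≤C x
  3<0 : c3 ≤C c0
  4<0 : c4 ≤C c0
  3<1 : c3 ≤C c1
  5<1 : c5 ≤C c1
  4<2 : c4 ≤C c2
  5<2 : c5 ≤C c2

record IsRightRegularBand {A : Set} (_·_ : A → A → A) : Set where
  field
    assoc    : ∀ x y z → (x · y) · z ≡ x · (y · z)
    idem     : ∀ x → x · x ≡ x
    rightReg : ∀ x y → (x · y) · x ≡ y · x

{-# OPTIONS --safe #-}
module Submission where

-- Write x ≼ y for x · y ≡ x. In a right-regular band x · y ≼ y, and every
-- common lower bound of x and y is ≼ x · y. For two maximal elements x, y of
-- the crown with common lower bound z this forces either x · y ≡ y and
-- y · x ≡ x, or x · y ≡ y · x ≡ z. The second option holds for at most one of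
-- the three pairs: for pairs {x, w} and {y, w} of this kind, a common lower
-- bound z of x and y gives z · w ≡ x · w and z · w ≡ y · w, two different
-- minimal elements. The first option is transitive, so it holds for all
-- pairs. Then c2 is a left identity for c0 and c1, so u = c3 · c2 satisfies
-- u · c0 ≡ c3 ≡ u · c1; but u ≤ c2 shares a lower bound other than c3 with c0
-- or with c1, and that bound would lie below c3.

open import Defs
open import Data.Empty using (⊥; ⊥-elim)
open import Data.Product using (Σ; _×_; _,_; proj₁; proj₂)
open import Data.Sum using (_⊎_; inj₁; inj₂)
open import Function.Bundles using (_⇔_; module Equivalence)
open import Relation.Binary.PropositionalEquality
  using (_≡_; refl; sym; trans; cong; subst; module ≡-Reasoning)
open import Relation.Nullary using (¬_; contradiction)

module RightRegularBandProperties {A : Set} {_·_ : A → A → A}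
                                  (isRRB : IsRightRegularBand _·_) where
  open IsRightRegularBand isRRB
  open ≡-Reasoning

  infix 4 _≼_

  _≼_ : A → A → Set
  x ≼ y = x · y ≡ x

  ·-≼ʳ : ∀ x y → x · y ≼ y
  ·-≼ʳ x y = trans (assoc x y y) (cong (x ·_) (idem y))

  ·-greatest : ∀ {x y z} → z ≼ x → z ≼ y → z ≼ x · y
  ·-greatest {x} {y} {z} z≼x z≼y = begin
    z · (x · y)  ≡⟨ sym (assoc z x y) ⟩
    (z · x) · y  ≡⟨ cong (_· y) z≼x ⟩
    z · y        ≡⟨ z≼y ⟩
    z            ∎

  ≼ˡ⇒·-comm : ∀ {x y} → x · y ≼ x → y · x ≡ x · y
  ≼ˡ⇒·-comm {x} {y} xy≼x = trans (sym (rightReg x y)) xy≼x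

  ≼⇒·-assocˡ : ∀ {x y} z → x ≼ y → x · (y · z) ≡ x · z
  ≼⇒·-assocˡ {x} {y} z x≼y = trans (sym (assoc x y z)) (cong (_· z) x≼y)

  rightZero-trans : ∀ {x y z} → x · y ≡ y → y · z ≡ z → x · z ≡ z
  rightZero-trans {x} {y} {z} xy≡y yz≡z = begin
    x · z        ≡⟨ cong (x ·_) (sym yz≡z) ⟩
    x · (y · z)  ≡⟨ sym (assoc x y z) ⟩
    (x · y) · z  ≡⟨ cong (_· z) xy≡y ⟩
    y · z        ≡⟨ yz≡z ⟩
    z            ∎

IsMinimal : C → Set
IsMinimal m = ∀ {z} → z ≤C m → z ≡ m

c3-minimal : IsMinimal c3
c3-minimal refl≤ = refl

c4-minimal : IsMinimal c4
c4-minimal refl≤ = refl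

c5-minimal : IsMinimal c5
c5-minimal refl≤ = refl

≤C⇒≡⊎minimal : ∀ {x y} → x ≤C y → x ≡ y ⊎ IsMinimal x
≤C⇒≡⊎minimal refl≤ = inj₁ refl
≤C⇒≡⊎minimal 3<0   = inj₂ c3-minimal
≤C⇒≡⊎minimal 4<0   = inj₂ c4-minimal
≤C⇒≡⊎minimal 3<1   = inj₂ c3-minimal
≤C⇒≡⊎minimal 5<1   = inj₂ c5-minimal
≤C⇒≡⊎minimal 4<2   = inj₂ c4-minimal
≤C⇒≡⊎minimal 5<2   = inj₂ c5-minimal

module Crown (_·_ : C → C → C) (isRRB : IsRightRegularBand _·_)
             (≤C⇔ : ∀ x y → (x ≤C y) ⇔ (x · y ≡ x)) where
  open IsRightRegularBand isRRB using (assoc)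
  open RightRegularBandProperties isRRB

  ≤C⇒≼ : ∀ {x y} → x ≤C y → x ≼ y
  ≤C⇒≼ {x} {y} = Equivalence.to (≤C⇔ x y)

  ≼⇒≤C : ∀ {x y} → x ≼ y → x ≤C y
  ≼⇒≤C {x} {y} = Equivalence.from (≤C⇔ x y)

  ·-≤Cʳ : ∀ x y → (x · y) ≤C y
  ·-≤Cʳ x y = ≼⇒≤C (·-≼ʳ x y)

  ·-≤C-greatest : ∀ {x y z} → z ≤C x → z ≤C y → z ≤C (x · y)
  ·-≤C-greatest z≤x z≤y = ≼⇒≤C (·-greatest (≤C⇒≼ z≤x) (≤C⇒≼ z≤y))

  RightZeroPair : C → C → Set
  RightZeroPair x y = x · y ≡ y × y · x ≡ x

  MeetPair : C → C → C → Set
  MeetPair x y z = x · y ≡ z × y · x ≡ z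

  ·-lowerBound-dichotomy : ∀ {x y z} → z ≤C x → z ≤C y → x · y ≡ y ⊎ x · y ≡ z
  ·-lowerBound-dichotomy {x} {y} z≤x z≤y with ≤C⇒≡⊎minimal (·-≤Cʳ x y)
  ... | inj₁ xy≡y       = inj₁ xy≡y
  ... | inj₂ xy-minimal = inj₂ (sym (xy-minimal (·-≤C-greatest z≤x z≤y)))

  meet-comm : ∀ {x y z} → z ≤C x → x · y ≡ z → y · x ≡ z
  meet-comm z≤x xy≡z =
    trans (≼ˡ⇒·-comm (subst (_≼ _) (sym xy≡z) (≤C⇒≼ z≤x))) xy≡z

  pair-dichotomy : ∀ {x y z} → z ≤C x → z ≤C y → ¬ y ≤C x →
                   RightZeroPair x y ⊎ MeetPair x y z
  pair-dichotomy z≤x z≤y y≰x with ·-lowerBound-dichotomy z≤x z≤y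
  ... | inj₂ xy≡z = inj₂ (xy≡z , meet-comm z≤x xy≡z)
  ... | inj₁ xy≡y with ·-lowerBound-dichotomy z≤y z≤x
  ...   | inj₁ yx≡x = inj₁ (xy≡y , yx≡x)
  ...   | inj₂ yx≡z =
          ⊥-elim (y≰x (subst (_≤C _) (trans (sym (meet-comm z≤y yx≡z)) xy≡y) z≤x))

  ·-minimal-below : ∀ {v w z m} → z ≤C v → v · w ≡ m → IsMinimal m → z · w ≡ m
  ·-minimal-below {v} {w} {z} {m} z≤v vw≡m m-minimal = begin
    z · w        ≡⟨ sym (≼⇒·-assocˡ w (≤C⇒≼ z≤v)) ⟩
    z · (v · w)  ≡⟨ cong (z ·_) vw≡m ⟩
    z · m        ≡⟨ m-minimal (·-≤Cʳ z m) ⟩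
    m            ∎
    where open ≡-Reasoning

  meets-agree : ∀ {x y z w m m′} → z ≤C x → z ≤C y → x · w ≡ m → y · w ≡ m′ →
                IsMinimal m → IsMinimal m′ → m ≡ m′
  meets-agree z≤x z≤y xw≡m yw≡m′ m-minimal m′-minimal =
    trans (sym (·-minimal-below z≤x xw≡m m-minimal))
          (·-minimal-below z≤y yw≡m′ m′-minimal)

  allRightZero : RightZeroPair c0 c1 × RightZeroPair c1 c2 × RightZeroPair c2 c0
  allRightZero
    with pair-dichotomy 3<0 3<1 (λ ())
       | pair-dichotomy 5<1 5<2 (λ ())
       | pair-dichotomy 4<2 4<0 (λ ())
  ... | inj₁ r01 | inj₁ r12 | inj₁ r20 = r01 , r12 , r20
  ... | inj₂ m01 | inj₂ m12 | _ =
        contradiction (meets-agree 4<0 4<2 (proj₁ m01) (proj₂ m12) c3-minimal c5-minimal) λ ()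
  ... | inj₂ m01 | _ | inj₂ m20 =
        contradiction (meets-agree 5<1 5<2 (proj₂ m01) (proj₁ m20) c3-minimal c4-minimal) λ ()
  ... | _ | inj₂ m12 | inj₂ m20 =
        contradiction (meets-agree 3<1 3<0 (proj₁ m12) (proj₂ m20) c5-minimal c4-minimal) λ ()
  ... | inj₂ m01 | inj₁ r12 | inj₁ r20 =
        contradiction (trans (sym (proj₁ m01)) (rightZero-trans (proj₂ r20) (proj₂ r12))) λ ()
  ... | inj₁ r01 | inj₂ m12 | inj₁ r20 =
        contradiction (trans (sym (proj₁ m12)) (rightZero-trans (proj₂ r01) (proj₂ r20))) λ ()
  ... | inj₁ r01 | inj₁ r12 | inj₂ m20 =
        contradiction (trans (sym (proj₁ m20)) (rightZero-trans (proj₂ r12) (proj₂ r01))) λ ()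

  c2-not-leftIdentity : c2 · c0 ≡ c0 → c2 · c1 ≡ c1 → ⊥
  c2-not-leftIdentity 20≡0 21≡1 =
    below-c2 (·-≤Cʳ c3 c2) (c3·c2·y≡c3 20≡0 3<0) (c3·c2·y≡c3 21≡1 3<1)
    where
      c3·c2·y≡c3 : ∀ {y} → c2 · y ≡ y → c3 ≤C y → (c3 · c2) · y ≡ c3
      c3·c2·y≡c3 2y≡y 3≤y =
        trans (assoc c3 c2 _) (trans (cong (c3 ·_) 2y≡y) (≤C⇒≼ 3≤y))

      below-c2 : ∀ {u} → u ≤C c2 → u · c0 ≡ c3 → u · c1 ≡ c3 → ⊥
      below-c2 refl≤ u0≡3 _ with subst (c4 ≤C_) u0≡3 (·-≤C-greatest 4<2 4<0)
      ... | ()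
      below-c2 4<2 u0≡3 _ with subst (c4 ≤C_) u0≡3 (·-≤C-greatest refl≤ 4<0)
      ... | ()
      below-c2 5<2 _ u1≡3 with subst (c5 ≤C_) u1≡3 (·-≤C-greatest refl≤ 5<1)
      ... | ()

propositionA3 : ¬ (Σ (C → C → C) λ op → IsRightRegularBand op × (∀ x y → (x ≤C y) ⇔ (op x y ≡ x)))
propositionA3 (_·_ , isRRB , ≤C⇔) = c2-not-leftIdentity (proj₁ r20) (proj₂ r12)
  where
    open Crown _·_ isRRB ≤C⇔
    r12 : RightZeroPair c1 c2
    r12 = proj₁ (proj₂ allRightZero)
    r20 : RightZeroPair c2 c0
    r20 = proj₂ (proj₂ allRightZero)
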